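{- Let $\mathfrak{X}$ be an association scheme, and suppose there exist vertices $u,v,w$ with $c(u,v)=s$, $c(v,w)=r$, $c(u,w)=t$ (a triangle with sides of colors $(s,r,t)$). Then for all colors $i,j,l$, $$p^s_{i,j}+p^r_{j,l}\le k_j+p^t_{i,l}.$$
   Context: An association scheme on a finite vertex set $V$ is a surjective map $c:V\times V\to\{0,1,\dots,r-1\}$ such that $c(u,v)=0$ iff $u=v$, $c(u,v)=c(v,u)$, and for all colors $i,j,t$ there is an integer $p^t_{i,j}$ such that whenever $c(u,v)=t$ there are exactly $p^t_{i,j}$ vertices $w$ with $c(u,w)=i$, $c(w,v)=j$. For a color $i$, $k_i=p^0_{i,i}$ is the number of vertices $w$ with $c(u,w)=i$, for any $u$. -}

module Defs where

open import Data.Nat using (ℕ; suc)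
open import Data.Fin using (Fin; zero)
open import Data.Fin.Properties using (_≟_)


open import Data.List using (List; filter; length; allFin)
open import Data.Product using (Σ)

open import Relation.Binary.PropositionalEquality using (_≡_)
open import Relation.Nullary.Decidable using (Dec; _×-dec_)
open import Function.Bundles using (_⇔_)

countPaths : {n m : ℕ} → (Fin n → Fin n → Fin m) →
             Fin n → Fin n → Fin m → Fin m → ℕ
countPaths {n} c u v i j =
  length (filter (λ w → (c u w ≟ i) ×-dec (c w v ≟ j)) (allFin n))

-- An association scheme on vertex set Fin n with colors Fin (suc m)
-- (so color 0 exists), exactly as in the paper's definition.
record AssociationScheme (n m : ℕ) : Set where
  field
    c         : Fin n → Fin n → Fin (suc m)
    surj      : ∀ (i : Fin (suc m)) → Σ (Fin n) (λ u → Σ (Fin n) (λ v → c u v ≡ i))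
    zero-iff  : ∀ u v → (c u v ≡ zero) ⇔ (u ≡ v)
    symm      : ∀ u v → c u v ≡ c v u
    p         : Fin (suc m) → Fin (suc m) → Fin (suc m) → ℕ
    -- p t i j = p^t_{i,j}
    regular   : ∀ i j t u v → c u v ≡ t → countPaths c u v i j ≡ p t i j

  k : Fin (suc m) → ℕ
  k i = p zero i i

module Submission where

open import Defs
open import Data.Nat using (ℕ; suc; _+_; _≤_)
open import Data.Nat.Properties using (+-suc; +-mono-≤; module ≤-Reasoning)
open import Data.Fin using (Fin; zero)
open import Data.Fin.Properties using (_≟_)
open import Data.List using (List; []; _∷_; filter; length; allFin)
open import Data.List.Relation.Binary.Sublist.Heterogeneous.Properties using (length-mono-≤)
open import Data.List.Relation.Binary.Sublist.Propositional using (⊆-refl)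
open import Data.List.Relation.Binary.Sublist.Propositional.Properties using (filter⁺)
open import Data.Bool using (true; false)
open import Data.Product using (_,_)
open import Data.Sum using (inj₁; inj₂)
open import Level using (Level)
open import Relation.Nullary using (does)
open import Relation.Nullary.Decidable using (_×-dec_)
open import Relation.Unary using (Pred; Decidable; _⊆_; _∪_; _∩_)
open import Relation.Unary.Properties using (_∪?_; _∩?_)
open import Relation.Binary.PropositionalEquality using (_≡_; refl; sym; trans; cong; cong₂)
open import Function.Bundles using (Equivalence)

-- Double counting the common vertices x of the walks u → x → v and v → x → w:
-- those with c(u,x) = i, c(x,v) = j and those with c(v,x) = j, c(x,w) = l both lie
-- among the k_j vertices with c(v,x) = j, and a vertex of both kinds has
-- c(u,x) = i and c(x,w) = l.  Inclusion–exclusion gives the inequality.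

module _ {a ℓ : Level} {A : Set a} where

  length-filter-mono : {P Q : Pred A ℓ} (P? : Decidable P) (Q? : Decidable Q) →
                       P ⊆ Q → (xs : List A) →
                       length (filter P? xs) ≤ length (filter Q? xs)
  length-filter-mono P? Q? P⊆Q xs = length-mono-≤ (filter⁺ P? Q? (λ { refl → P⊆Q }) (⊆-refl {x = xs}))

  length-filter-∪-∩ : {P Q : Pred A ℓ} (P? : Decidable P) (Q? : Decidable Q) (xs : List A) →
                      length (filter P? xs) + length (filter Q? xs) ≡
                      length (filter (P? ∪? Q?) xs) + length (filter (P? ∩? Q?) xs)
  length-filter-∪-∩ P? Q? [] = refl
  length-filter-∪-∩ P? Q? (x ∷ xs) with ih ← length-filter-∪-∩ P? Q? xs | does (P? x) | does (Q? x)
  ... | true  | true  = cong suc (trans (+-suc _ _) (trans (cong suc ih) (sym (+-suc _ _))))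
  ... | true  | false = cong suc ih
  ... | false | true  = trans (+-suc _ _) (cong suc ih)
  ... | false | false = ih

  length-filter-+-≤ : {P Q R S : Pred A ℓ}
                      (P? : Decidable P) (Q? : Decidable Q) (R? : Decidable R) (S? : Decidable S) →
                      P ⊆ R → Q ⊆ R → P ∩ Q ⊆ S → (xs : List A) →
                      length (filter P? xs) + length (filter Q? xs) ≤
                      length (filter R? xs) + length (filter S? xs)
  length-filter-+-≤ {P} {Q} {R} P? Q? R? S? P⊆R Q⊆R P∩Q⊆S xs = begin
    length (filter P? xs) + length (filter Q? xs)
      ≡⟨ length-filter-∪-∩ P? Q? xs ⟩
    length (filter (P? ∪? Q?) xs) + length (filter (P? ∩? Q?) xs)
      ≤⟨ +-mono-≤ (length-filter-mono (P? ∪? Q?) R? P∪Q⊆R xs)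
                  (length-filter-mono (P? ∩? Q?) S? P∩Q⊆S xs) ⟩
    length (filter R? xs) + length (filter S? xs) ∎
    where
    open ≤-Reasoning
    P∪Q⊆R : P ∪ Q ⊆ R
    P∪Q⊆R (inj₁ p) = P⊆R p
    P∪Q⊆R (inj₂ q) = Q⊆R q

countPaths-triangle : {n m : ℕ} (c : Fin n → Fin n → Fin m) → (∀ x y → c x y ≡ c y x) →
                      ∀ u v w i j l →
                      countPaths c u v i j + countPaths c v w j l ≤
                      countPaths c v v j j + countPaths c u w i l
countPaths-triangle {n} c symm u v w i j l =
  length-filter-+-≤ (λ x → (c u x ≟ i) ×-dec (c x v ≟ j)) (λ x → (c v x ≟ j) ×-dec (c x w ≟ l))
                    (λ x → (c v x ≟ j) ×-dec (c x v ≟ j)) (λ x → (c u x ≟ i) ×-dec (c x w ≟ l))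
                    (λ { (_ , xv≡j) → trans (symm v _) xv≡j , xv≡j })
                    (λ { (vx≡j , _) → vx≡j , trans (symm _ v) vx≡j })
                    (λ { ((ux≡i , _) , (_ , xw≡l)) → ux≡i , xw≡l })
                    (allFin n)

module _ {n m : ℕ} (X : AssociationScheme n m) where
  open AssociationScheme X

  countPaths-loop≡k : ∀ v j → countPaths c v v j j ≡ k j
  countPaths-loop≡k v j = regular j j zero v v (Equivalence.from (zero-iff v v) refl)

lemma4p5 : ∀ {n m : ℕ} (X : AssociationScheme n m) →
    let open AssociationScheme X in
    ∀ (s r t : Fin (suc m)) (u v w : Fin n) →
    c u v ≡ s → c v w ≡ r → c u w ≡ t →
    ∀ (i j l : Fin (suc m)) →
    p s i j + p r j l ≤ k j + p t i l
lemma4p5 X s r t u v w cuv≡s cvw≡r cuw≡t i j l = begin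
  p s i j + p r j l
    ≡⟨ sym (cong₂ _+_ (regular i j s u v cuv≡s) (regular j l r v w cvw≡r)) ⟩
  countPaths c u v i j + countPaths c v w j l
    ≤⟨ countPaths-triangle c symm u v w i j l ⟩
  countPaths c v v j j + countPaths c u w i l
    ≡⟨ cong₂ _+_ (countPaths-loop≡k X v j) (regular i l t u w cuw≡t) ⟩
  k j + p t i l ∎
  where
  open AssociationScheme X
  open ≤-Reasoning
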